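{- Let $\Psi$ be a weighted directed graph with finite vertex set ${\tt N}$, let $\aleph$ be a partition of ${\tt N}$ by which $\Psi$ is tree-divisible, let $F'\in{\cal F}^k(\Psi|\aleph)$ and let $F$ be a principal of $F'$. Then $F$ is a minimal principal of $F'$ if and only if all of the following hold: (i) $\Upsilon^F_{\tt Z}=\lambda^\bullet_{\tt Z}$ for every ${\tt Z}\in\aleph$ containing a root of $F$; (ii) $\Upsilon^F_{\tt X}=\lambda_{\tt XY}$ for every arc $({\tt X},{\tt Y})$ of $F'$; (iii) $\Upsilon^{F|_{\tt X}}=\lambda^{\bullet x}_{\tt X}$ for every ${\tt X}\in\aleph$, where $x$ is the root of the tree $F|_{\tt X}$.
   Context: $\Psi$ has real arc weights $\psi_{ij}$. An entering forest is a directed graph in which at most one arc leaves each vertex and there are no directed cycles; its components are entering trees, whose root is the unique vertex with no outgoing arc. ${\cal F}^k(G)$ is the set of spanning entering forests of $G$ with exactly $k$ trees. For a subgraph $G$ of $\Psi$ and ${\tt D}\subseteq{\tt N}$, $\Upsilon^G_{\tt D}=\sum_{(i,j)\in{\tt A}G,\ i\in{\tt D}}\psi_{ij}$ (arcs with tail in ${\tt D}$, head arbitrary), $\Upsilon^G=\Upsilon^G_{\tt N}$; $G|_{\tt D}$ is the induced subgraph. For a spanning subgraph $G$ of $\Psi$ and ${\tt D}\subseteq{\tt N}$: ${\cal T}^{\bullet q}_{\tt D}(G)$ is the set of entering trees in $G$ with vertex set ${\tt D}$ and root $q\in{\tt D}$, ${\cal T}^\bullet_{\tt D}(G)=\bigcup_{q\in{\tt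 D}}{\cal T}^{\bullet q}_{\tt D}(G)$, $\lambda^{\bullet q}_{\tt D}(G)=\min_{T\in{\cal T}^{\bullet q}_{\tt D}(G)}\Upsilon^T$, $\lambda^\bullet_{\tt D}(G)=\min_q\lambda^{\bullet q}_{\tt D}(G)$; ${\cal T}^\circ_{\tt D}(G)$ is the set of entering trees $T\subseteq G$ with ${\tt D}\subset{\tt V}T$, $|{\tt V}T|=|{\tt D}|+1$, $T|_{\tt D}\in{\cal T}^\bullet_{\tt D}(G)$. For distinct ${\tt X},{\tt Y}\in\aleph$, ${\cal T}_{\tt XY}(G)$ is the set of $T\in{\cal T}^\circ_{\tt X}(G)$ with root in ${\tt Y}$ and $\lambda_{\tt XY}(G)=\min_{T\in{\cal T}_{\tt XY}(G)}\Upsilon^T$. When $G=\Psi$ the argument is omitted. $G$ is tree-divisible by $\aleph$ if ${\cal T}^\bullet_{\tt X}(G)\ne\emptyset$ for all ${\tt X}\in\aleph$. The splitting $G|\aleph=G^\aleph$ of a tree-divisible $G$ has vertex set $\aleph$ and an arc $({\tt X},{\tt Y})$, ${\tt X}\neq{\tt Y}$, iff ${\cal T}_{\tt XY}(G)\ne\emptyset$, of weight $\lambda_{\tt XY}(G)-\lambda^\bullet_{\tt X}(G)$. A tree-divisible $F\in{\cal F}^k(\Psi)$ is a principal of a spanning entering forest $F'$ of $\Psi|\aleph$ if the arc set of $F'$ equals that of $F^\aleph$. A minimal principal of $F'$ is a principal $F$ of $F'$ with $\Upsilon^F$ minimal among all principals of $F'$. -}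

module Defs where

open import Data.Nat using (ℕ; zero; suc; _+_)
open import Data.Fin using (Fin; zero; suc; _≟_)
open import Data.Bool using (Bool; true; false; _∧_; _∨_; if_then_else_; not)
open import Data.Sum using (_⊎_)
open import Data.Product using (Σ; ∃; _×_; _,_)
open import Relation.Binary.PropositionalEquality using (_≡_; _≢_; refl)
open import Relation.Nullary using (¬_)
open import Relation.Nullary.Decidable using (⌊_⌋)
open import Relation.Binary.Construct.Closure.Transitive using (TransClosure)
open import Relation.Binary.Construct.Closure.ReflexiveTransitive using (Star)

-- Weights: the paper uses real weights; we work over an arbitrary
-- totally ordered abelian group (ℝ is an instance).

record OrderedAbelianGroup : Set₁ where
  infixl 6 _+ʷ_
  infix  4 _≤ʷ_
  field
    W          : Set
    _+ʷ_       : W → W → W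
    0ʷ         : W
    -ʷ_        : W → W
    +-assoc    : ∀ x y z → (x +ʷ y) +ʷ z ≡ x +ʷ (y +ʷ z)
    +-comm     : ∀ x y → x +ʷ y ≡ y +ʷ x
    +-identityˡ : ∀ x → 0ʷ +ʷ x ≡ x
    -‿inverseˡ : ∀ x → (-ʷ x) +ʷ x ≡ 0ʷ
    _≤ʷ_       : W → W → Set
    ≤-refl     : ∀ x → x ≤ʷ x
    ≤-trans    : ∀ {x y z} → x ≤ʷ y → y ≤ʷ z → x ≤ʷ z
    ≤-antisym  : ∀ {x y} → x ≤ʷ y → y ≤ʷ x → x ≡ y
    ≤-total    : ∀ x y → (x ≤ʷ y) ⊎ (y ≤ʷ x)
    +-monoˡ-≤  : ∀ {x y} z → x ≤ʷ y → x +ʷ z ≤ʷ y +ʷ z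

count : ∀ {n} → (Fin n → Bool) → ℕ
count {zero}  p = 0
count {suc n} p = (if p zero then 1 else 0) + count (λ i → p (suc i))

anyFin : ∀ {n} → (Fin n → Bool) → Bool
anyFin {zero}  p = false
anyFin {suc n} p = p zero ∨ anyFin (λ i → p (suc i))

record Subgraph (n : ℕ) : Set where
  field
    V      : Fin n → Bool
    A      : Fin n → Fin n → Bool
    closed : ∀ i j → A i j ≡ true → (V i ≡ true) × (V j ≡ true)
open Subgraph public

VSet : ℕ → Set
VSet n = Fin n → Bool

Arc : ∀ {n} → Subgraph n → Fin n → Fin n → Set
Arc H i j = A H i j ≡ true

_⊆ᵍ_ : ∀ {n} → Subgraph n → Subgraph n → Set
H ⊆ᵍ G = (∀ i → V H i ≡ true → V G i ≡ true) × (∀ i j → Arc H i j → Arc G i j)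

Spanning : ∀ {n} → Subgraph n → Set
Spanning H = ∀ i → V H i ≡ true

_∣_ : ∀ {n} → Subgraph n → VSet n → Subgraph n
V (H ∣ D) i = V H i ∧ D i
A (H ∣ D) i j = A H i j ∧ (D i ∧ D j)
closed (H ∣ D) i j e = helper (A H i j) (D i) (D j) (closed H i j) e
  where
  helper : ∀ a di dj → (a ≡ true → (V H i ≡ true) × (V H j ≡ true))
         → a ∧ (di ∧ dj) ≡ true → (V H i ∧ di ≡ true) × (V H j ∧ dj ≡ true)
  helper true true true k _ with k refl
  ... | p , q rewrite p | q = refl , refl

EnteringForest : ∀ {n} → Subgraph n → Set
EnteringForest H =
  (∀ i j j′ → Arc H i j → Arc H i j′ → j ≡ j′) ×
  (∀ i → ¬ TransClosure (Arc H) i i)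

IsRoot : ∀ {n} → Subgraph n → Fin n → Set
IsRoot H q = (V H q ≡ true) × (∀ j → ¬ Arc H q j)

-- entering tree with root q: entering forest, q a root, every vertex
-- has a directed path to q (so H is connected and q is its unique root)
EnteringTree : ∀ {n} → Subgraph n → Fin n → Set
EnteringTree H q =
  EnteringForest H × IsRoot H q × (∀ i → V H i ≡ true → Star (Arc H) i q)

-- number of trees of an entering forest = number of its roots
numTrees : ∀ {n} → Subgraph n → ℕ
numTrees H = count (λ i → V H i ∧ not (anyFin (A H i)))

InForests : ∀ {n} → ℕ → Subgraph n → Subgraph n → Set
InForests k G F = (F ⊆ᵍ G) × Spanning F × EnteringForest F × (numTrees F ≡ k)

SameVertices : ∀ {n} → Subgraph n → VSet n → Set
SameVertices T D = ∀ i → V T i ≡ D i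

Tbq : ∀ {n} → Subgraph n → VSet n → Fin n → Subgraph n → Set
Tbq G D q T = (T ⊆ᵍ G) × SameVertices T D × EnteringTree T q

Tb : ∀ {n} → Subgraph n → VSet n → Subgraph n → Set
Tb G D T = ∃ λ q → Tbq G D q T

Tc : ∀ {n} → Subgraph n → VSet n → Subgraph n → Set
Tc G D T =
  (T ⊆ᵍ G) × (∃ λ r → EnteringTree T r) ×
  (∀ i → D i ≡ true → V T i ≡ true) ×
  (count (V T) ≡ suc (count D)) ×
  Tb G D (T ∣ D)

-- Partitions ℵ of Fin n into m (nonempty) blocks, given by block map

IsPartition : ∀ {n m} → (Fin n → Fin m) → Set
IsPartition {m = m} blk = ∀ (X : Fin m) → ∃ λ i → blk i ≡ X

Block : ∀ {n m} → (Fin n → Fin m) → Fin m → VSet n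
Block blk X i = ⌊ blk i ≟ X ⌋

Txy : ∀ {n m} → Subgraph n → (Fin n → Fin m) → Fin m → Fin m → Subgraph n → Set
Txy G blk X Y T = Tc G (Block blk X) T × (∃ λ r → EnteringTree T r × (blk r ≡ Y))

TreeDivisible : ∀ {n m} → Subgraph n → (Fin n → Fin m) → Set
TreeDivisible {m = m} G blk = ∀ (X : Fin m) → ∃ λ T → Tb G (Block blk X) T

SplitArc : ∀ {n m} → Subgraph n → (Fin n → Fin m) → Fin m → Fin m → Set
SplitArc G blk X Y = (X ≢ Y) × (∃ λ T → Txy G blk X Y T)

InSplitForests : ∀ {n m} → ℕ → Subgraph n → (Fin n → Fin m) → Subgraph m → Set
InSplitForests k G blk F′ =
  (∀ X Y → Arc F′ X Y → SplitArc G blk X Y) ×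
  Spanning F′ × EnteringForest F′ × (numTrees F′ ≡ k)

Principal : ∀ {n m} → ℕ → Subgraph n → (Fin n → Fin m) → Subgraph m → Subgraph n → Set
Principal k Ψ blk F′ F =
  InForests k Ψ F × TreeDivisible F blk ×
  (∀ X Y → (Arc F′ X Y → SplitArc F blk X Y) × (SplitArc F blk X Y → Arc F′ X Y))

module Weighted (OG : OrderedAbelianGroup) where
  open OrderedAbelianGroup OG

  sumFin : ∀ {n} → (Fin n → W) → W
  sumFin {zero}  f = 0ʷ
  sumFin {suc n} f = f zero +ʷ sumFin (λ i → f (suc i))

  Υ_ : ∀ {n} → (Fin n → Fin n → W) → Subgraph n → VSet n → W
  Υ_ ψ H D = sumFin (λ i → sumFin (λ j → if A H i j ∧ D i then ψ i j else 0ʷ))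

  Υall : ∀ {n} → (Fin n → Fin n → W) → Subgraph n → W
  Υall ψ H = Υ_ ψ H (λ _ → true)

  IsMinOf : ∀ {n} → (Fin n → Fin n → W) → (Subgraph n → Set) → W → Set
  IsMinOf ψ P v = (∃ λ T → P T × (Υall ψ T ≡ v)) × (∀ T → P T → v ≤ʷ Υall ψ T)

  MinimalPrincipal : ∀ {n m} → (Fin n → Fin n → W) → ℕ → Subgraph n → (Fin n → Fin m)
                   → Subgraph m → Subgraph n → Set
  MinimalPrincipal ψ k Ψ blk F′ F =
    Principal k Ψ blk F′ F ×
    (∀ F″ → Principal k Ψ blk F′ F″ → Υall ψ F ≤ʷ Υall ψ F″)

{-# OPTIONS --safe #-}
module Submission where

-- A principal F of F′ contains, for every block X, an entering tree on X whose root q_X is either a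
-- root of F or the tail of the one arc of F from X to the block Y with (X,Y) ∈ F′. Since at most one
-- arc leaves each vertex, the arcs of F with tail in X are exactly the arcs of that tree, plus that
-- arc; hence Υ^F = Σ_X Υ^F_X, where Υ^F_X is the weight of a member of 𝒯•_X or of 𝒯_XY.
-- Replacing the arcs of F with tail in X by those of any other member of the same family yields
-- again a principal of F′, so minimality forces (i) and (ii). Conversely (i) and (ii) compare
-- Υ^F_X with the X-summand of every other principal, which makes F minimal. Finally (iii) reduces
-- to the same two bounds: when q_X is not a root of F, attach the arc of F leaving q_X to a
-- competing tree on X rooted at q_X, and cancel the weight of that arc.

open import Defs
open import Algebra.Bundles using (CommutativeMonoid)
import Algebra.Properties.CommutativeMonoid.Sum as MonoidSum
open import Data.Bool using (Bool; true; false; _∧_; _∨_; not; if_then_else_)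
import Data.Bool as Bool
open import Data.Bool.Properties
  using (∧-identityʳ; ∧-zeroʳ; ∨-identityʳ; ∧-comm; ∧-abs-∨; ¬-not; not-¬; ⇔→≡)
open import Data.Empty using (⊥; ⊥-elim)
open import Data.Fin using (Fin; zero; suc; _≟_)
open import Data.Fin.Properties using (any?; 0≢1+n; suc-injective)
open import Data.Nat using (ℕ; zero; suc; _+_; _≤_; _<_; z≤n; s≤s)
import Data.Nat.Properties as ℕₚ
open import Data.Product using (∃; _×_; _,_; proj₁; proj₂)
open import Data.Sum using (_⊎_; inj₁; inj₂; [_,_]′)
open import Function using (_∘_)
open import Function.Bundles using (_⇔_; mk⇔)
open import Level using (0ℓ)
open import Relation.Binary.PropositionalEquality
open import Relation.Nullary using (¬_; yes; no)
open import Relation.Nullary.Decidable using (⌊_⌋; dec-true; dec-false; isYes≗does)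
open import Relation.Binary.Construct.Closure.Transitive using (TransClosure; [_]; _∷_; _++_)
open import Relation.Binary.Construct.Closure.ReflexiveTransitive as Star using (Star; ε; _◅_; _◅◅_)

∧-elim : ∀ a {b} → a ∧ b ≡ true → a ≡ true × b ≡ true
∧-elim true e = refl , e

∧-intro : ∀ {a b} → a ≡ true → b ≡ true → a ∧ b ≡ true
∧-intro refl refl = refl

∨-elim : ∀ a {b} → a ∨ b ≡ true → a ≡ true ⊎ b ≡ true
∨-elim true  _ = inj₁ refl
∨-elim false e = inj₂ e

∨-introˡ : ∀ {a} b → a ≡ true → a ∨ b ≡ true
∨-introˡ _ refl = refl

∨-introʳ : ∀ a {b} → b ≡ true → a ∨ b ≡ true
∨-introʳ true  _ = refl
∨-introʳ false e = e

true-or-false : ∀ b → b ≡ true ⊎ b ≡ false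
true-or-false true  = inj₁ refl
true-or-false false = inj₂ refl

≟-sound : ∀ {n} {i j : Fin n} → ⌊ i ≟ j ⌋ ≡ true → i ≡ j
≟-sound {i = i} {j} e with i ≟ j
... | yes p = p

≟-complete : ∀ {n} {i j : Fin n} → i ≡ j → ⌊ i ≟ j ⌋ ≡ true
≟-complete {i = i} {j} = trans (isYes≗does (i ≟ j)) ∘ dec-true (i ≟ j)

≟-≢ : ∀ {n} {i j : Fin n} → i ≢ j → ⌊ i ≟ j ⌋ ≡ false
≟-≢ {i = i} {j} = trans (isYes≗does (i ≟ j)) ∘ dec-false (i ≟ j)

≟-suc : ∀ {n} (i j : Fin n) → ⌊ suc i ≟ suc j ⌋ ≡ ⌊ i ≟ j ⌋
≟-suc i j with i ≟ j
... | yes _ = refl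
... | no  _ = refl

≟-refl : ∀ {n} (i : Fin n) → ⌊ i ≟ i ⌋ ≡ true
≟-refl i = ≟-complete refl

module _ {n m : ℕ} (blk : Fin n → Fin m) where

  ∈Block : ∀ {X i} → blk i ≡ X → Block blk X i ≡ true
  ∈Block = ≟-complete

  ∉Block : ∀ {X i} → blk i ≢ X → Block blk X i ≡ false
  ∉Block = ≟-≢

  Block-sound : ∀ {X i} → Block blk X i ≡ true → blk i ≡ X
  Block-sound = ≟-sound

_⊆ᵛ_ : ∀ {n} → VSet n → VSet n → Set
P ⊆ᵛ Q = ∀ i → P i ≡ true → Q i ≡ true

insert : ∀ {n} → Fin n → VSet n → VSet n
insert w P i = P i ∨ ⌊ i ≟ w ⌋

count-cong : ∀ {n} {p q : VSet n} → (∀ i → p i ≡ q i) → count p ≡ count q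
count-cong {zero}  h = refl
count-cong {suc n} h rewrite h zero = cong (_ +_) (count-cong (λ i → h (suc i)))

count-≡0 : ∀ {n} {p : VSet n} → (∀ i → p i ≡ false) → count p ≡ 0
count-≡0 {zero}  h = refl
count-≡0 {suc n} h rewrite h zero = count-≡0 (λ i → h (suc i))

count-≡1 : ∀ {n} {p : VSet n} (a : Fin n) → p a ≡ true → (∀ i → p i ≡ true → i ≡ a) → count p ≡ 1
count-≡1 {suc n} {p} zero pa only rewrite pa =
  cong suc (count-≡0 (λ i → ¬-not (0≢1+n ∘ sym ∘ only (suc i))))
count-≡1 {suc n} {p} (suc a) pa only with true-or-false (p zero)
... | inj₁ e with () ← only zero e
... | inj₂ e rewrite e = count-≡1 a pa (λ i e′ → suc-injective (only (suc i) e′))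

count-split : ∀ {n} (X p : VSet n) → count p ≡ count (λ i → X i ∧ p i) + count (λ i → not (X i) ∧ p i)
count-split {zero}  X p = refl
count-split {suc n} X p with X zero | p zero | count-split (λ i → X (suc i)) (λ i → p (suc i))
... | true  | true  | ih = cong suc ih
... | true  | false | ih = ih
... | false | true  | ih = trans (cong suc ih) (sym (ℕₚ.+-suc _ _))
... | false | false | ih = ih

n≤indicator+n : ∀ b k → k ≤ (if b then 1 else 0) + k
n≤indicator+n true  k = ℕₚ.n≤1+n k
n≤indicator+n false k = ℕₚ.≤-refl

count-mono : ∀ {n} {p q : VSet n} → p ⊆ᵛ q → count p ≤ count q
count-mono {zero}  h = z≤n
count-mono {suc n} {p} {q} h with true-or-false (p zero)
... | inj₁ e rewrite e | h zero e = s≤s (count-mono (λ i → h (suc i)))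
... | inj₂ e rewrite e = ℕₚ.≤-trans (count-mono (λ i → h (suc i))) (n≤indicator+n (q zero) _)

count-mono-< : ∀ {n} {p q : VSet n} (a : Fin n) → p ⊆ᵛ q → p a ≡ false → q a ≡ true → count p < count q
count-mono-< {suc n} {p} {q} zero h pa qa rewrite pa | qa = s≤s (count-mono (λ i → h (suc i)))
count-mono-< {suc n} {p} {q} (suc a) h pa qa with true-or-false (p zero)
... | inj₁ e rewrite e | h zero e = s≤s (count-mono-< a (λ i → h (suc i)) pa qa)
... | inj₂ e rewrite e = ℕₚ.≤-trans (count-mono-< a (λ i → h (suc i)) pa qa) (n≤indicator+n (q zero) _)

count-insert : ∀ {n} {p : VSet n} (w : Fin n) → p w ≡ false → count (insert w p) ≡ suc (count p)
count-insert {suc n} {p} zero pw rewrite pw = cong suc (count-cong (λ i → ∨-identityʳ (p (suc i))))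
count-insert {suc n} {p} (suc w) pw
  with p zero
     | trans (count-cong (λ i → cong (p (suc i) ∨_) (≟-suc i w))) (count-insert {p = λ i → p (suc i)} w pw)
... | true  | ih = cong suc ih
... | false | ih = ih

unique-extra : ∀ {n} {X V : VSet n} {a b : Fin n} → X ⊆ᵛ V → count V ≡ suc (count X) →
               V a ≡ true → X a ≡ false → V b ≡ true → X b ≡ false → a ≡ b
unique-extra {X = X} {V} {a} {b} X⊆V size Va Xa Vb Xb with a ≟ b
... | yes a≡b = a≡b
... | no  a≢b = ⊥-elim (ℕₚ.<⇒≢ (ℕₚ.≤-trans (s≤s X<X+a) X+a<V) (sym size))
  where
  X+a⊆V : insert a X ⊆ᵛ V
  X+a⊆V i e with ∨-elim (X i) e
  ... | inj₁ Xi = X⊆V i Xi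
  ... | inj₂ i≡a rewrite ≟-sound i≡a = Va
  X<X+a : count X < count (insert a X)
  X<X+a = count-mono-< a (λ i → ∨-introˡ _) Xa (∨-introʳ (X a) (≟-refl a))
  X+a<V : count (insert a X) < count V
  X+a<V = count-mono-< b X+a⊆V (subst (λ x → x ∨ _ ≡ false) (sym Xb) (≟-≢ (a≢b ∘ sym))) Vb

Functional : ∀ {n} → Subgraph n → Set
Functional H = ∀ i j j′ → Arc H i j → Arc H i j′ → j ≡ j′

Acyclic : ∀ {n} → Subgraph n → Set
Acyclic H = ∀ i → ¬ TransClosure (Arc H) i i

⊆ᵍ-trans : ∀ {n} {H G K : Subgraph n} → H ⊆ᵍ G → G ⊆ᵍ K → H ⊆ᵍ K
⊆ᵍ-trans (HV , HA) (GV , GA) = (λ i → GV i ∘ HV i) , (λ i j → GA i j ∘ HA i j)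

∣-⊆ᵍ : ∀ {n} (H : Subgraph n) D → (H ∣ D) ⊆ᵍ H
∣-⊆ᵍ H D = (λ i → proj₁ ∘ ∧-elim (V H i)) , (λ i j → proj₁ ∘ ∧-elim (A H i j))

∣-arc : ∀ {n} {H : Subgraph n} {D i j} → Arc H i j → D i ≡ true → D j ≡ true → Arc (H ∣ D) i j
∣-arc a Di Dj = ∧-intro a (∧-intro Di Dj)

∣-arc⁻ : ∀ {n} {H : Subgraph n} {D i j} → Arc (H ∣ D) i j → Arc H i j × D i ≡ true × D j ≡ true
∣-arc⁻ {H = H} {D} {i} {j} a = let a′ , DiDj = ∧-elim (A H i j) a in a′ , ∧-elim (D i) DiDj

module _ {a ℓ} {I : Set a} {R : I → I → Set ℓ} where

  TransClosure-map : ∀ {ℓ′} {S : I → I → Set ℓ′} → (∀ {i j} → R i j → S i j) →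
                     ∀ {x y} → TransClosure R x y → TransClosure S x y
  TransClosure-map f [ r ]    = [ f r ]
  TransClosure-map f (r ∷ rs) = f r ∷ TransClosure-map f rs

  _◅⁺_ : ∀ {x y z} → R x y → Star R y z → TransClosure R x z
  r ◅⁺ ε         = [ r ]
  r ◅⁺ (r′ ◅ rs) = r ∷ (r′ ◅⁺ rs)

first-arc : ∀ {a ℓ} {I : Set a} {R : I → I → Set ℓ} {x y} → TransClosure R x y → ∃ (R x)
first-arc [ r ]   = _ , r
first-arc (r ∷ _) = _ , r

nonroot-arc : ∀ {n} {U : Subgraph n} {u a} → EnteringTree U u → V U a ≡ true → a ≢ u → ∃ (Arc U a)
nonroot-arc (_ , _ , reach) Va a≢u with reach _ Va
... | ε     = ⊥-elim (a≢u refl)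
... | e ◅ _ = _ , e

root-has-no-arc : ∀ {n} {H : Subgraph n} {r j} → IsRoot H r → ¬ Arc H r j
root-has-no-arc (_ , noArc) = noArc _

anyFin-true : ∀ {n} {p : VSet n} j → p j ≡ true → anyFin p ≡ true
anyFin-true {p = p} zero    pj rewrite pj = refl
anyFin-true {p = p} (suc j) pj = ∨-introʳ (p zero) (anyFin-true {p = λ i → p (suc i)} j pj)

anyFin-false : ∀ {n} {p : VSet n} → (∀ j → p j ≡ false) → anyFin p ≡ false
anyFin-false {zero}  none = refl
anyFin-false {suc n} none rewrite none zero = anyFin-false (λ j → none (suc j))

IsRootᵇ : ∀ {n} → Subgraph n → VSet n
IsRootᵇ H i = V H i ∧ not (anyFin (A H i))

rootsIn : ∀ {n} → VSet n → Subgraph n → ℕ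
rootsIn D H = count (λ i → D i ∧ IsRootᵇ H i)

numTrees-split : ∀ {n} (D : VSet n) H → numTrees H ≡ rootsIn D H + rootsIn (λ i → not (D i)) H
numTrees-split D H = count-split D (IsRootᵇ H)

arc⇒¬IsRootᵇ : ∀ {n} {H : Subgraph n} {i j} (D : VSet n) → Arc H i j → D i ∧ IsRootᵇ H i ≡ false
arc⇒¬IsRootᵇ {H = H} {i} {j} D a rewrite anyFin-true {p = A H i} j a | ∧-zeroʳ (V H i) = ∧-zeroʳ (D i)

rootsIn-≡0 : ∀ {n} {D : VSet n} {H} → (∀ i → D i ≡ true → ∃ (Arc H i)) → rootsIn D H ≡ 0
rootsIn-≡0 {D = D} {H} arcs = count-≡0 no-root
  where
  no-root : ∀ i → D i ∧ IsRootᵇ H i ≡ false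
  no-root i with true-or-false (D i)
  ... | inj₁ i∈D = arc⇒¬IsRootᵇ {H = H} {i} D (proj₂ (arcs i i∈D))
  ... | inj₂ i∉D rewrite i∉D = refl

rootsIn-≡1 : ∀ {n} {D : VSet n} {H r} → IsRoot H r → D r ≡ true →
             (∀ i → D i ≡ true → i ≢ r → ∃ (Arc H i)) → rootsIn D H ≡ 1
rootsIn-≡1 {D = D} {H} {r} (Vr , noArc) r∈D arcs =
  count-≡1 r (∧-intro r∈D (∧-intro Vr (cong not (anyFin-false (λ j → ¬-not (noArc j)))))) only-r
  where
  only-r : ∀ i → D i ∧ IsRootᵇ H i ≡ true → i ≡ r
  only-r i e with i ≟ r
  ... | yes i≡r = i≡r
  ... | no  i≢r = let c , a = arcs i (proj₁ (∧-elim (D i) e)) i≢r in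
    ⊥-elim (not-¬ e (arc⇒¬IsRootᵇ {H = H} {i} D a))

module TreeIn {n} {G : Subgraph n} {D : VSet n} {u : Fin n} {U : Subgraph n} (t : Tbq G D u U) where

  U⊆G : U ⊆ᵍ G
  U⊆G = proj₁ t

  U-arc⇒G-arc : ∀ {i j} → Arc U i j → Arc G i j
  U-arc⇒G-arc = proj₂ U⊆G _ _

  tree : EnteringTree U u
  tree = proj₂ (proj₂ t)

  arc-inside : ∀ {i j} → Arc U i j → D i ≡ true × D j ≡ true
  arc-inside {i} {j} a = let Vi , Vj = closed U i j a in
    trans (sym (proj₁ (proj₂ t) i)) Vi , trans (sym (proj₁ (proj₂ t) j)) Vj

  root-inside : D u ≡ true
  root-inside = trans (sym (proj₁ (proj₂ t) u)) (proj₁ (proj₁ (proj₂ tree)))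

  step : ∀ {i} → D i ≡ true → i ≢ u → ∃ (Arc U i)
  step {i} Di = nonroot-arc {U = U} tree (trans (proj₁ (proj₂ t) i) Di)

  G-step : ∀ {i} → D i ≡ true → i ≢ u → ∃ (Arc G i)
  G-step Di i≢u = let c , a = step Di i≢u in c , U-arc⇒G-arc a

  U-path : ∀ {i} → D i ≡ true → Star (Arc U) i u
  U-path {i} Di = proj₂ (proj₂ tree) i (trans (proj₁ (proj₂ t) i) Di)

  reaches-root : ∀ {i} → D i ≡ true → Star (Arc G) i u
  reaches-root = Star.map U-arc⇒G-arc ∘ U-path

  U-arc⇒restricted-arc : ∀ {i j} → Arc U i j → Arc (G ∣ D) i j
  U-arc⇒restricted-arc a = ∣-arc {H = G} {D} (U-arc⇒G-arc a) (proj₁ (arc-inside a)) (proj₂ (arc-inside a))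

  restriction-root : ∀ {x} → IsRoot (G ∣ D) x → x ≡ u
  restriction-root {x} root with x ≟ u
  ... | yes x≡u = x≡u
  ... | no  x≢u = let c , xc = step (proj₂ (∧-elim (V G x) (proj₁ root))) x≢u in
    ⊥-elim (root-has-no-arc {H = G ∣ D} root (U-arc⇒restricted-arc xc))

  module _ (functional : Functional G) where

    G-arc⇒U-arc : ∀ {i j} → Arc G i j → D i ≡ true → i ≢ u → Arc U i j
    G-arc⇒U-arc {i} {j} a Di i≢u = let c , ic = step Di i≢u in
      subst (Arc U i) (functional i c j (U-arc⇒G-arc ic) a) ic

    leaving-arc-from-root : ∀ {i j} → Arc G i j → D i ≡ true → D j ≡ false → i ≡ u
    leaving-arc-from-root {i} a Di Dj with i ≟ u
    ... | yes i≡u = i≡u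
    ... | no  i≢u = ⊥-elim (not-¬ (proj₂ (arc-inside (G-arc⇒U-arc a Di i≢u))) Dj)

    arcs-at-root : IsRoot G u → ∀ i j → A U i j ≡ A G i j ∧ D i
    arcs-at-root root i j = ⇔→≡ (mk⇔ to from)
      where
      to : Arc U i j → A G i j ∧ D i ≡ true
      to a = ∧-intro (U-arc⇒G-arc a) (proj₁ (arc-inside a))
      from : A G i j ∧ D i ≡ true → Arc U i j
      from e = let a , Di = ∧-elim (A G i j) e in
        G-arc⇒U-arc a Di (λ { refl → root-has-no-arc {H = G} root a })

    module _ (acyclic : Acyclic G) where

      root-arc-leaves : ∀ {j} → Arc G u j → D j ≡ false
      root-arc-leaves a = ¬-not (λ Dj → acyclic u (a ◅⁺ reaches-root Dj))

      arcs-of-restriction : ∀ i j → A (G ∣ D) i j ≡ A U i j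
      arcs-of-restriction i j = ⇔→≡ (mk⇔ to U-arc⇒restricted-arc)
        where
        to : Arc (G ∣ D) i j → Arc U i j
        to e = let a , Di , Dj = ∣-arc⁻ {H = G} {D} e in
          G-arc⇒U-arc a Di (λ { refl → not-¬ Dj (root-arc-leaves {j} a) })

module ExtendedTree {n} {G : Subgraph n} {D : VSet n} {T : Subgraph n} {r : Fin n}
                    (tc : Tc G D T) (tree : EnteringTree T r) (r∉D : D r ≡ false) where

  T-arc⇒G-arc : ∀ {i j} → Arc T i j → Arc G i j
  T-arc⇒G-arc = proj₂ (proj₁ tc) _ _

  D⊆VT : D ⊆ᵛ V T
  D⊆VT = proj₁ (proj₂ (proj₂ tc))

  only-root-outside : ∀ {b} → V T b ≡ true → D b ≡ false → b ≡ r
  only-root-outside Vb Db =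
    unique-extra D⊆VT (proj₁ (proj₂ (proj₂ (proj₂ tc)))) Vb Db (proj₁ (proj₁ (proj₂ tree))) r∉D

  tails-inside : ∀ {i j} → Arc T i j → D i ≡ true
  tails-inside {i} {j} a with true-or-false (D i)
  ... | inj₁ Di = Di
  ... | inj₂ Di = ⊥-elim (root-has-no-arc {H = T} (proj₁ (proj₂ tree))
                            (subst (λ x → Arc T x j) (only-root-outside (proj₁ (closed T i j a)) Di) a))

  step : ∀ {i} → D i ≡ true → ∃ (Arc T i)
  step Di = nonroot-arc {U = T} tree (D⊆VT _ Di) (λ { refl → not-¬ Di r∉D })

  module _ (functional : Functional G) where

    arcs : ∀ i j → A T i j ≡ A G i j ∧ D i
    arcs i j = ⇔→≡ (mk⇔ to from)
      where
      to : Arc T i j → A G i j ∧ D i ≡ true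
      to a = ∧-intro (T-arc⇒G-arc a) (tails-inside a)
      from : A G i j ∧ D i ≡ true → Arc T i j
      from e = let a , Di = ∧-elim (A G i j) e ; c , ic = step Di in
        subst (Arc T i) (functional i c j (T-arc⇒G-arc ic) a) ic

    -- The root x of T ∣ D has its T-arc leaving D, so x is the root u of any tree of G on D
    -- and that arc is the G-arc from u to r.
    root-arc : ∀ {u U} → Tbq G D u U → Arc G u r
    root-arc {u} {U} t = subst₂ (Arc G) (Tu.leaving-arc-from-root functional xw′ Dx Dw) w≡r xw′
      where
      module Tu = TreeIn {G = G} {D} {u} {U} t
      x = proj₁ (proj₂ (proj₂ (proj₂ (proj₂ tc))))
      module Tx = TreeIn {G = G} {D} {x} {T ∣ D} (proj₂ (proj₂ (proj₂ (proj₂ (proj₂ tc)))))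
      Dx : D x ≡ true
      Dx = Tx.root-inside
      w = proj₁ (step Dx)
      xw : Arc T x w
      xw = proj₂ (step Dx)
      xw′ : Arc G x w
      xw′ = T-arc⇒G-arc xw
      Dw : D w ≡ false
      Dw = ¬-not (λ Dw → root-has-no-arc {H = T ∣ D} (proj₁ (proj₂ Tx.tree)) (∣-arc {H = T} {D} xw Dx Dw))
      w≡r : w ≡ r
      w≡r = only-root-outside (proj₂ (closed T x w xw)) Dw

module Attach {n} {G : Subgraph n} {D : VSet n} {u : Fin n} {U : Subgraph n} (t : Tbq G D u U)
              (w : Fin n) (w∉D : D w ≡ false) where
  open TreeIn {G = G} {D} {u} {U} t using (arc-inside; root-inside; tree; U-arc⇒G-arc; U-path)

  new-arc : Fin n → Fin n → Bool
  new-arc i j = ⌊ i ≟ u ⌋ ∧ ⌊ j ≟ w ⌋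

  arc-cases : ∀ {i j} → A U i j ∨ new-arc i j ≡ true → Arc U i j ⊎ (i ≡ u × j ≡ w)
  arc-cases {i} {j} e with ∨-elim (A U i j) e
  ... | inj₁ a = inj₁ a
  ... | inj₂ b = let i≡u , j≡w = ∧-elim ⌊ i ≟ u ⌋ b in inj₂ (≟-sound i≡u , ≟-sound j≡w)

  extended : Subgraph n
  extended = record { V = insert w D ; A = λ i j → A U i j ∨ new-arc i j ; closed = extended-closed }
    where
    extended-closed : ∀ i j → A U i j ∨ new-arc i j ≡ true → insert w D i ≡ true × insert w D j ≡ true
    extended-closed i j e with arc-cases e
    ... | inj₁ a             = ∨-introˡ _ (proj₁ (arc-inside a)) , ∨-introˡ _ (proj₂ (arc-inside a))
    ... | inj₂ (refl , refl) = ∨-introˡ _ root-inside , ∨-introʳ (D w) (≟-refl w)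

  U-arc⇒extended-arc : ∀ {i j} → Arc U i j → Arc extended i j
  U-arc⇒extended-arc = ∨-introˡ _

  new-arc-∈extended : Arc extended u w
  new-arc-∈extended = ∨-introʳ (A U u w) (∧-intro (≟-refl u) (≟-refl w))

  w-is-root : ∀ j → ¬ Arc extended w j
  w-is-root j e with arc-cases e
  ... | inj₁ a          = not-¬ (proj₁ (arc-inside a)) w∉D
  ... | inj₂ (w≡u , _)  = not-¬ (subst (λ x → D x ≡ true) (sym w≡u) root-inside) w∉D

  extended-functional : Functional extended
  extended-functional i j j′ e e′ with arc-cases e | arc-cases e′
  ... | inj₁ a         | inj₁ a′         = proj₁ (proj₁ tree) i j j′ a a′
  ... | inj₁ a         | inj₂ (refl , _) = ⊥-elim (root-has-no-arc {H = U} (proj₁ (proj₂ tree)) a)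
  ... | inj₂ (refl , _) | inj₁ a′        = ⊥-elim (root-has-no-arc {H = U} (proj₁ (proj₂ tree)) a′)
  ... | inj₂ (_ , j≡w) | inj₂ (_ , j′≡w) = trans j≡w (sym j′≡w)

  path-cases : ∀ {a b} → TransClosure (Arc extended) a b → TransClosure (Arc U) a b ⊎ b ≡ w
  path-cases [ e ] with arc-cases e
  ... | inj₁ a       = inj₁ [ a ]
  ... | inj₂ (_ , q) = inj₂ q
  path-cases (e ∷ p) with arc-cases e
  ... | inj₂ (_ , refl) = ⊥-elim (w-is-root _ (proj₂ (first-arc p)))
  ... | inj₁ a with path-cases p
  ...   | inj₁ q = inj₁ (a ∷ q)
  ...   | inj₂ q = inj₂ q

  extended-acyclic : Acyclic extended
  extended-acyclic a cycle with path-cases cycle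
  ... | inj₁ q    = proj₂ (proj₁ tree) a q
  ... | inj₂ refl = w-is-root _ (proj₂ (first-arc cycle))

  extended-tree : EnteringTree extended w
  extended-tree = (extended-functional , extended-acyclic) , (∨-introʳ (D w) (≟-refl w) , w-is-root) , reaches-w
    where
    reaches-w : ∀ i → insert w D i ≡ true → Star (Arc extended) i w
    reaches-w i e with ∨-elim (D i) e
    ... | inj₁ Di  = Star.map U-arc⇒extended-arc (U-path Di) ◅◅ (new-arc-∈extended ◅ ε)
    ... | inj₂ i≡w rewrite ≟-sound i≡w = ε

  restricted-arc : ∀ {i j} → Arc (extended ∣ D) i j → Arc U i j
  restricted-arc {i} {j} e with ∧-elim (A extended i j) e
  ... | a , DiDj with arc-cases a
  ...   | inj₁ a′         = a′
  ...   | inj₂ (_ , refl) = ⊥-elim (not-¬ (proj₂ (∧-elim (D i) DiDj)) w∉D)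

  restriction-tree : EnteringTree (extended ∣ D) u
  restriction-tree =
    ((λ i j j′ e e′ → proj₁ (proj₁ tree) i j j′ (restricted-arc e) (restricted-arc e′)) ,
     (λ a cycle → proj₂ (proj₁ tree) a (TransClosure-map restricted-arc cycle))) ,
    (∧-intro (∨-introˡ _ root-inside) root-inside ,
     (λ j e → root-has-no-arc {H = U} (proj₁ (proj₂ tree)) (restricted-arc e))) ,
    (λ i e → Star.map U-arc⇒restricted-arc (U-path (proj₂ (∧-elim (insert w D i) e))))
    where
    U-arc⇒restricted-arc : ∀ {i j} → Arc U i j → Arc (extended ∣ D) i j
    U-arc⇒restricted-arc a =
      ∣-arc {H = extended} {D} (U-arc⇒extended-arc a) (proj₁ (arc-inside a)) (proj₂ (arc-inside a))

  extended-∈Tc : Spanning G → Arc G u w → Tc G D extended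
  extended-∈Tc spanning uw =
    extended⊆G , (w , extended-tree) , (λ i → ∨-introˡ _) , count-insert w w∉D ,
    (u , ⊆ᵍ-trans {H = extended ∣ D} {extended} {G} (∣-⊆ᵍ extended D) extended⊆G ,
         same-vertices , restriction-tree)
    where
    extended⊆G : extended ⊆ᵍ G
    extended⊆G = (λ i _ → spanning i) , λ i j e → [ U-arc⇒G-arc , (λ { (refl , refl) → uw }) ]′ (arc-cases e)
    same-vertices : SameVertices (extended ∣ D) D
    same-vertices i = trans (∧-comm (insert w D i) (D i)) (∧-abs-∨ (D i) _)

Tbq-⊆ᵍ : ∀ {n} {G G′ : Subgraph n} {D u T} → Tbq G D u T → T ⊆ᵍ G′ → Tbq G′ D u T
Tbq-⊆ᵍ (_ , same , tree) T⊆G′ = T⊆G′ , same , tree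

module _ {n m : ℕ} (blk : Fin n → Fin m) where

  Txy-⊆ᵍ : ∀ {G G′ : Subgraph n} {X Y T} → Txy G blk X Y T → T ⊆ᵍ G′ → Txy G′ blk X Y T
  Txy-⊆ᵍ {G′ = G′} {X} {T = T} ((_ , tree , D⊆V , size , (x , _ , same , treeX)) , rooted) T⊆G′ =
    (T⊆G′ , tree , D⊆V , size ,
     (x , ⊆ᵍ-trans {H = T ∣ Block blk X} {T} {G′} (∣-⊆ᵍ T _) T⊆G′ , same , treeX)) ,
    rooted

  module TxyTree {G : Subgraph n} {X Y T} (txy : Txy G blk X Y T) (X≢Y : X ≢ Y) =
    ExtendedTree {G = G} {Block blk X} {T} {proj₁ (proj₂ txy)} (proj₁ txy) (proj₁ (proj₂ (proj₂ txy)))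
                 (∉Block blk (λ r∈X → X≢Y (trans (sym r∈X) (proj₂ (proj₂ (proj₂ txy))))))

  module _ {G : Subgraph n} {X u U} (t : Tbq G (Block blk X) u U) where

    SplitArc⇒root-arc : Functional G → ∀ {Y} → SplitArc G blk X Y → ∃ λ y → Arc G u y × blk y ≡ Y
    SplitArc⇒root-arc functional {Y} (X≢Y , T , txy) =
      proj₁ (proj₂ txy) ,
      TxyTree.root-arc {G = G} {X} {Y} {T} txy X≢Y functional {u} {U} t ,
      proj₂ (proj₂ (proj₂ txy))

    root-arc⇒SplitArc : Spanning G → ∀ {y} → Arc G u y → Block blk X y ≡ false → SplitArc G blk X (blk y)
    root-arc⇒SplitArc spanning {y} uy y∉X =
      (λ X≡y → not-¬ (∈Block blk (sym X≡y)) y∉X) ,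
      extended , extended-∈Tc spanning uy , (y , extended-tree , refl)
      where open Attach {G = G} {Block blk X} {u} {U} t y y∉X

module OfPrincipal {n m : ℕ} {k : ℕ} {Ψ : Subgraph n} {blk : Fin n → Fin m} {F′ : Subgraph m} {F : Subgraph n}
                   (principal : Principal k Ψ blk F′ F) where

  F⊆Ψ : F ⊆ᵍ Ψ
  F⊆Ψ = proj₁ (proj₁ principal)

  spanning : Spanning F
  spanning = proj₁ (proj₂ (proj₁ principal))

  Ψ-spanning : Spanning Ψ
  Ψ-spanning i = proj₁ F⊆Ψ i (spanning i)

  functional : Functional F
  functional = proj₁ (proj₁ (proj₂ (proj₂ (proj₁ principal))))

  acyclic : Acyclic F
  acyclic = proj₂ (proj₁ (proj₂ (proj₂ (proj₁ principal))))

  numTrees≡k : numTrees F ≡ k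
  numTrees≡k = proj₂ (proj₂ (proj₂ (proj₁ principal)))

  F′-arc⇒SplitArc : ∀ {X Y} → Arc F′ X Y → SplitArc F blk X Y
  F′-arc⇒SplitArc {X} {Y} = proj₁ (proj₂ (proj₂ principal) X Y)

  SplitArc⇒F′-arc : ∀ {X Y} → SplitArc F blk X Y → Arc F′ X Y
  SplitArc⇒F′-arc {X} {Y} = proj₂ (proj₂ (proj₂ principal) X Y)

  tree : Fin m → Subgraph n
  tree X = proj₁ (proj₁ (proj₂ principal) X)

  root : Fin m → Fin n
  root X = proj₁ (proj₂ (proj₁ (proj₂ principal) X))

  tree-∈Tbq : ∀ X → Tbq F (Block blk X) (root X) (tree X)
  tree-∈Tbq X = proj₂ (proj₂ (proj₁ (proj₂ principal) X))

  module Tree (X : Fin m) = TreeIn {G = F} {Block blk X} {root X} {tree X} (tree-∈Tbq X)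

  tree-∈Tbq-Ψ : ∀ X → Tbq Ψ (Block blk X) (root X) (tree X)
  tree-∈Tbq-Ψ X = Tbq-⊆ᵍ {G = F} {Ψ} {Block blk X} {root X} {tree X} (tree-∈Tbq X)
                          (⊆ᵍ-trans {H = tree X} {F} {Ψ} (Tree.U⊆G X) F⊆Ψ)

  _⇝_ : Fin m → Fin m → Set
  X ⇝ Y = TransClosure (Arc F) (root X) (root Y)

  Txy-in-Ψ : ∀ {X Y T} → Txy F blk X Y T → Txy Ψ blk X Y T
  Txy-in-Ψ {X} {Y} {T} txy =
    Txy-⊆ᵍ blk {F} {Ψ} {X} {Y} {T} txy (⊆ᵍ-trans {H = T} {F} {Ψ} (proj₁ (proj₁ txy)) F⊆Ψ)

  reaches-own-root : ∀ i → Star (Arc F) i (root (blk i))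
  reaches-own-root i = Tree.reaches-root (blk i) (∈Block blk refl)

  root-or-arc : ∀ X → IsRoot F (root X) ⊎ ∃ (Arc F (root X))
  root-or-arc X with any? (λ j → A F (root X) j Bool.≟ true)
  ... | yes arc   = inj₂ arc
  ... | no  noArc = inj₁ (spanning (root X) , λ j a → noArc (j , a))

  root-in-block : ∀ {X r} → IsRoot F r → Block blk X r ≡ true → r ≡ root X
  root-in-block {X} {r} isRoot r∈X with r ≟ root X
  ... | yes r≡root = r≡root
  ... | no  r≢root = ⊥-elim (root-has-no-arc {H = F} isRoot (proj₂ (Tree.G-step X r∈X r≢root)))

  F′-arc⇒root-arc : ∀ {X Y} → Arc F′ X Y → ∃ λ y → Arc F (root X) y × blk y ≡ Y
  F′-arc⇒root-arc {X} = SplitArc⇒root-arc blk {F} {X} {root X} {tree X} (tree-∈Tbq X) functional ∘ F′-arc⇒SplitArc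

  root-arc⇒F′-arc : ∀ {X y} → Arc F (root X) y → Arc F′ X (blk y)
  root-arc⇒F′-arc {X} a =
    SplitArc⇒F′-arc (root-arc⇒SplitArc blk {F} {X} {root X} {tree X} (tree-∈Tbq X) spanning a
                                        (Tree.root-arc-leaves X functional acyclic a))

-- Replacing the arcs of a principal with tail in one block

module Replacement {n m : ℕ} {k : ℕ} {Ψ : Subgraph n} {blk : Fin n → Fin m} {F′ : Subgraph m} {F : Subgraph n}
                   (principal : Principal k Ψ blk F′ F) (X : Fin m) (S : Subgraph n)
                   (S⊆Ψ : ∀ {i j} → Arc S i j → Arc Ψ i j)
                   (S-forest : EnteringForest S)
                   (S-tails : ∀ {i j} → Arc S i j → Block blk X i ≡ true)
                   where
  open OfPrincipal {k = k} {Ψ} {blk} {F′} {F} principal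

  inX : VSet n
  inX = Block blk X

  ExitsTowardsRoots : Set
  ExitsTowardsRoots = ∀ {i j} → Arc S i j → inX j ≡ false → X ⇝ blk j

  replaced : Subgraph n
  replaced = record
    { V = λ _ → true ; A = λ i j → if inX i then A S i j else A F i j ; closed = λ _ _ _ → refl , refl }

  arc-cases : ∀ {i j} → Arc replaced i j → (inX i ≡ true × Arc S i j) ⊎ (inX i ≡ false × Arc F i j)
  arc-cases {i} with inX i
  ... | true  = λ a → inj₁ (refl , a)
  ... | false = λ a → inj₂ (refl , a)

  S-arc⇒replaced : ∀ {i j} → inX i ≡ true → Arc S i j → Arc replaced i j
  S-arc⇒replaced {i} {j} i∈X = subst (λ b → (if b then A S i j else A F i j) ≡ true) (sym i∈X)

  F-arc⇒replaced : ∀ {i j} → inX i ≡ false → Arc F i j → Arc replaced i j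
  F-arc⇒replaced {i} {j} i∉X = subst (λ b → (if b then A S i j else A F i j) ≡ true) (sym i∉X)

  replaced⇒S-arc : ∀ {i j} → inX i ≡ true → Arc replaced i j → Arc S i j
  replaced⇒S-arc i∈X a with arc-cases a
  ... | inj₁ (_ , s)    = s
  ... | inj₂ (i∉X , _) = ⊥-elim (not-¬ i∈X i∉X)

  replaced⇒F-arc : ∀ {i j} → inX i ≡ false → Arc replaced i j → Arc F i j
  replaced⇒F-arc i∉X a with arc-cases a
  ... | inj₁ (i∈X , _) = ⊥-elim (not-¬ i∈X i∉X)
  ... | inj₂ (_ , f)    = f

  replaced⊆Ψ : replaced ⊆ᵍ Ψ
  replaced⊆Ψ = (λ i _ → Ψ-spanning i) , λ i j a → [ S⊆Ψ ∘ proj₂ , proj₂ F⊆Ψ i j ∘ proj₂ ]′ (arc-cases a)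

  replaced-functional : Functional replaced
  replaced-functional i j j′ a a′ with arc-cases a | arc-cases a′
  ... | inj₁ (_ , s)    | inj₁ (_ , s′)   = proj₁ S-forest i j j′ s s′
  ... | inj₂ (_ , f)    | inj₂ (_ , f′)   = functional i j j′ f f′
  ... | inj₁ (i∈X , _) | inj₂ (i∉X , _) = ⊥-elim (not-¬ i∈X i∉X)
  ... | inj₂ (i∉X , _) | inj₁ (i∈X , _) = ⊥-elim (not-¬ i∈X i∉X)

  -- A path of the replacement either stays in one block, or else F has a path between the roots
  -- of its first and last blocks: arcs of F and of S leave a block only towards such roots.
  Within : Fin m → Fin n → Fin n → Set
  Within B a b = Arc replaced a b × blk a ≡ B × blk b ≡ B

  Progress : Fin n → Fin n → Set
  Progress a b = TransClosure (Within (blk a)) a b ⊎ blk a ⇝ blk b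

  within-end : ∀ {B a b} → TransClosure (Within B) a b → blk b ≡ B
  within-end [ (_ , _ , b∈B) ] = b∈B
  within-end (_ ∷ p)           = within-end p

  module _ (S-exits : ExitsTowardsRoots) where

    crossing : ∀ {a b} → Arc replaced a b → blk b ≢ blk a → blk a ⇝ blk b
    crossing {a} {b} e b∉a with arc-cases e
    ... | inj₁ (a∈X , s) = subst (_⇝ blk b) (sym (Block-sound blk a∈X))
                                  (S-exits s (∉Block blk (λ b∈X → b∉a (trans b∈X (sym (Block-sound blk a∈X))))))
    ... | inj₂ (_ , f)    = subst (λ x → Arc F x b) a≡root f ◅⁺ reaches-own-root b
      where
      a≡root : a ≡ root (blk a)
      a≡root = Tree.leaving-arc-from-root (blk a) functional f (∈Block blk refl) (∉Block blk b∉a)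

    arc-progress : ∀ {a b} → Arc replaced a b → Progress a b
    arc-progress {a} {b} e with blk b ≟ blk a
    ... | yes b∈a = inj₁ [ (e , refl , b∈a) ]
    ... | no  b∉a = inj₂ (crossing e b∉a)

    progress-++ : ∀ {a b c} → Progress a b → Progress b c → Progress a c
    progress-++ {a} {b} {c} (inj₁ p) (inj₁ q) = inj₁ (p ++ subst (λ B → TransClosure (Within B) b c) (within-end p) q)
    progress-++ {a} {b} {c} (inj₁ p) (inj₂ q) = inj₂ (subst (_⇝ blk c) (within-end p) q)
    progress-++ {a} {b} {c} (inj₂ p) (inj₁ q) = inj₂ (subst (blk a ⇝_) (sym (within-end q)) p)
    progress-++             (inj₂ p) (inj₂ q) = inj₂ (p ++ q)

    path-progress : ∀ {a b} → TransClosure (Arc replaced) a b → Progress a b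
    path-progress [ e ]   = arc-progress e
    path-progress (e ∷ p) = progress-++ (arc-progress e) (path-progress p)

    replaced-acyclic : Acyclic replaced
    replaced-acyclic a cycle with path-progress cycle
    ... | inj₂ p = acyclic (root (blk a)) p
    ... | inj₁ p with true-or-false (inX a)
    ...   | inj₁ a∈X = proj₂ S-forest a (TransClosure-map in-S p)
      where
      in-S : ∀ {i j} → Within (blk a) i j → Arc S i j
      in-S (e , i∈a , _) = replaced⇒S-arc (∈Block blk (trans i∈a (Block-sound blk a∈X))) e
    ...   | inj₂ a∉X = acyclic a (TransClosure-map in-F p)
      where
      in-F : ∀ {i j} → Within (blk a) i j → Arc F i j
      in-F (e , i∈a , _) = replaced⇒F-arc (subst (λ B → ⌊ B ≟ X ⌋ ≡ false) (sym i∈a) a∉X) e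

  outside-roots : rootsIn (λ i → not (inX i)) replaced ≡ rootsIn (λ i → not (inX i)) F
  outside-roots = count-cong same
    where
    same : ∀ i → not (inX i) ∧ IsRootᵇ replaced i ≡ not (inX i) ∧ IsRootᵇ F i
    same i with inX i
    ... | true  = refl
    ... | false rewrite spanning i = refl

  replaced-numTrees : rootsIn inX replaced ≡ rootsIn inX F → numTrees replaced ≡ k
  replaced-numTrees same-inside = begin
    numTrees replaced                                                  ≡⟨ numTrees-split inX replaced ⟩
    rootsIn inX replaced + rootsIn (λ i → not (inX i)) replaced        ≡⟨ cong₂ _+_ same-inside outside-roots ⟩
    rootsIn inX F + rootsIn (λ i → not (inX i)) F                      ≡˘⟨ numTrees-split inX F ⟩
    numTrees F                                                         ≡⟨ numTrees≡k ⟩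
    k                                                                  ∎
    where open ≡-Reasoning

  module _ {B : Fin m} (B≢X : B ≢ X) where

    ∉X : ∀ {i} → Block blk B i ≡ true → inX i ≡ false
    ∉X i∈B = ∉Block blk (λ i∈X → B≢X (trans (sym (Block-sound blk i∈B)) i∈X))

    tree-⊆ᵍ-replaced : tree B ⊆ᵍ replaced
    tree-⊆ᵍ-replaced =
      (λ _ _ → refl) , λ i j a → F-arc⇒replaced (∉X (proj₁ (Tree.arc-inside B a))) (Tree.U-arc⇒G-arc B a)

    F-SplitArc⇒replaced : ∀ {C} → SplitArc F blk B C → SplitArc replaced blk B C
    F-SplitArc⇒replaced {C} (B≢C , T , txy) = B≢C , T , Txy-⊆ᵍ blk {F} {replaced} {B} {C} {T} txy
      ((λ _ _ → refl) , λ i j a → F-arc⇒replaced (∉X (TxyTree.tails-inside blk {F} {B} {C} {T} txy B≢C a))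
                                                  (proj₂ (proj₁ (proj₁ txy)) i j a))

    replaced-SplitArc⇒F : ∀ {C} → SplitArc replaced blk B C → SplitArc F blk B C
    replaced-SplitArc⇒F {C} (B≢C , T , txy) = B≢C , T , Txy-⊆ᵍ blk {replaced} {F} {B} {C} {T} txy
      ((λ i _ → spanning i) , λ i j a → replaced⇒F-arc (∉X (TxyTree.tails-inside blk {replaced} {B} {C} {T} txy B≢C a))
                                                       (proj₂ (proj₁ (proj₁ txy)) i j a))

  SplitArcsAt : Fin m → Set
  SplitArcsAt B = ∀ C → (Arc F′ B C → SplitArc replaced blk B C) × (SplitArc replaced blk B C → Arc F′ B C)

  replaced-principal : ExitsTowardsRoots → (∃ λ T → Tb replaced inX T) → rootsIn inX replaced ≡ rootsIn inX F →
                       SplitArcsAt X → Principal k Ψ blk F′ replaced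
  replaced-principal S-exits treeX same-roots split-arcs-X =
    (replaced⊆Ψ , (λ _ → refl) , (replaced-functional , replaced-acyclic S-exits) , replaced-numTrees same-roots) ,
    tree-divisible , split-arcs
    where
    tree-divisible : TreeDivisible replaced blk
    tree-divisible B with B ≟ X
    ... | yes refl = treeX
    ... | no  B≢X  = tree B , root B ,
                     Tbq-⊆ᵍ {G = F} {replaced} {Block blk B} {root B} {tree B} (tree-∈Tbq B) (tree-⊆ᵍ-replaced B≢X)
    split-arcs : ∀ B → SplitArcsAt B
    split-arcs B C with B ≟ X
    ... | yes refl = split-arcs-X C
    ... | no  B≢X  = F-SplitArc⇒replaced B≢X ∘ F′-arc⇒SplitArc , SplitArc⇒F′-arc ∘ replaced-SplitArc⇒F B≢X

module Weights (OG : OrderedAbelianGroup) where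
  open OrderedAbelianGroup OG
  open Weighted OG

  +-identityʳ : ∀ x → x +ʷ 0ʷ ≡ x
  +-identityʳ x = trans (+-comm x 0ʷ) (+-identityˡ x)

  +-cancelʳ-≤ : ∀ {x y} z → x +ʷ z ≤ʷ y +ʷ z → x ≤ʷ y
  +-cancelʳ-≤ {x} {y} z le = subst₂ _≤ʷ_ (undo x) (undo y) (+-monoˡ-≤ (-ʷ z) le)
    where
    undo : ∀ a → (a +ʷ z) +ʷ (-ʷ z) ≡ a
    undo a = begin
      (a +ʷ z) +ʷ (-ʷ z)  ≡⟨ +-assoc a z (-ʷ z) ⟩
      a +ʷ (z +ʷ (-ʷ z))  ≡⟨ cong (a +ʷ_) (trans (+-comm z (-ʷ z)) (-‿inverseˡ z)) ⟩
      a +ʷ 0ʷ             ≡⟨ +-identityʳ a ⟩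
      a                   ∎
      where open ≡-Reasoning

  +-mono-≤ : ∀ {x x′ y y′} → x ≤ʷ x′ → y ≤ʷ y′ → x +ʷ y ≤ʷ x′ +ʷ y′
  +-mono-≤ {x} {x′} {y} {y′} x≤x′ y≤y′ =
    ≤-trans (+-monoˡ-≤ y x≤x′) (subst₂ _≤ʷ_ (+-comm y x′) (+-comm y′ x′) (+-monoˡ-≤ x′ y≤y′))

  +-commutativeMonoid : CommutativeMonoid 0ℓ 0ℓ
  +-commutativeMonoid = record
    { Carrier = W ; _≈_ = _≡_ ; _∙_ = _+ʷ_ ; ε = 0ʷ
    ; isCommutativeMonoid = record
      { isMonoid = record
        { isSemigroup = record
          { isMagma = record { isEquivalence = isEquivalence ; ∙-cong = cong₂ _+ʷ_ }
          ; assoc = +-assoc }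
        ; identity = +-identityˡ , +-identityʳ }
      ; comm = +-comm } }

  open MonoidSum +-commutativeMonoid using (sum; sum-cong-≗; sum-replicate-zero; ∑-distrib-+; ∑-comm)

  sumFin≡sum : ∀ {n} (f : Fin n → W) → sumFin f ≡ sum f
  sumFin≡sum {zero}  f = refl
  sumFin≡sum {suc n} f = cong (f zero +ʷ_) (sumFin≡sum (λ i → f (suc i)))

  sumFin-mono-≤ : ∀ {n} {f g : Fin n → W} → (∀ i → f i ≤ʷ g i) → sumFin f ≤ʷ sumFin g
  sumFin-mono-≤ {zero}  f≤g = ≤-refl 0ʷ
  sumFin-mono-≤ {suc n} f≤g = +-mono-≤ (f≤g zero) (sumFin-mono-≤ (λ i → f≤g (suc i)))

  sum-indicator : ∀ {m} (c : Fin m) (v : W) → sum (λ B → if ⌊ c ≟ B ⌋ then v else 0ʷ) ≡ v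
  sum-indicator {suc m} zero v = trans (cong (v +ʷ_) (sum-replicate-zero m)) (+-identityʳ v)
  sum-indicator {suc m} (suc c) v = begin
    0ʷ +ʷ sum (λ B → if ⌊ suc c ≟ suc B ⌋ then v else 0ʷ)  ≡⟨ +-identityˡ _ ⟩
    sum (λ B → if ⌊ suc c ≟ suc B ⌋ then v else 0ʷ)        ≡⟨ sum-cong-≗ (λ B → cong (if_then v else 0ʷ) (≟-suc c B)) ⟩
    sum (λ B → if ⌊ c ≟ B ⌋ then v else 0ʷ)                ≡⟨ sum-indicator c v ⟩
    v                                                       ∎
    where open ≡-Reasoning

  if-∨ : ∀ a b (v : W) → (a ≡ true → b ≡ true → ⊥) →
         (if a ∨ b then v else 0ʷ) ≡ (if a then v else 0ʷ) +ʷ (if b then v else 0ʷ)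
  if-∨ true  true  v disjoint = ⊥-elim (disjoint refl refl)
  if-∨ true  false v _ = sym (+-identityʳ v)
  if-∨ false true  v _ = sym (+-identityˡ v)
  if-∨ false false v _ = sym (+-identityˡ 0ʷ)

  module _ {n} (ψ : Fin n → Fin n → W) where

    entry : (Fin n → Fin n → Bool) → Fin n → Fin n → W
    entry P i j = if P i j then ψ i j else 0ʷ

    weight : (Fin n → Fin n → Bool) → W
    weight P = sum (λ i → sum (entry P i))

    Υ≡weight : ∀ H D → Υ_ ψ H D ≡ weight (λ i j → A H i j ∧ D i)
    Υ≡weight H D = trans (sumFin≡sum (λ i → sumFin (entry P i))) (sum-cong-≗ (λ i → sumFin≡sum (entry P i)))
      where P = λ i j → A H i j ∧ D i

    weight-cong : ∀ {P Q} → (∀ i j → P i j ≡ Q i j) → weight P ≡ weight Q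
    weight-cong P≡Q = sum-cong-≗ (λ i → sum-cong-≗ (λ j → cong (if_then ψ i j else 0ʷ) (P≡Q i j)))

    weight-∪ : ∀ P Q → (∀ i j → P i j ≡ true → Q i j ≡ true → ⊥) →
               weight (λ i j → P i j ∨ Q i j) ≡ weight P +ʷ weight Q
    weight-∪ P Q disjoint = begin
      weight (λ i j → P i j ∨ Q i j)
        ≡⟨ sum-cong-≗ (λ i → trans (sum-cong-≗ (λ j → if-∨ (P i j) (Q i j) (ψ i j) (disjoint i j)))
                                   (∑-distrib-+ (entry P i) (entry Q i))) ⟩
      sum (λ i → sum (entry P i) +ʷ sum (entry Q i))
        ≡⟨ ∑-distrib-+ (λ i → sum (entry P i)) (λ i → sum (entry Q i)) ⟩
      weight P +ʷ weight Q
        ∎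
      where open ≡-Reasoning

    Υ-cong : ∀ {H H′ D D′} → (∀ i j → A H i j ∧ D i ≡ A H′ i j ∧ D′ i) → Υ_ ψ H D ≡ Υ_ ψ H′ D′
    Υ-cong {H} {H′} {D} {D′} same = trans (Υ≡weight H D) (trans (weight-cong same) (sym (Υ≡weight H′ D′)))

    Υall-cong : ∀ {H H′ D′} → (∀ i j → A H i j ≡ A H′ i j ∧ D′ i) → Υall ψ H ≡ Υ_ ψ H′ D′
    Υall-cong {H} {H′} {D′} same =
      Υ-cong {H} {H′} {λ _ → true} {D′} (λ i j → trans (∧-identityʳ (A H i j)) (same i j))

    Υ-∪ : ∀ {H H′ D D′} P → (∀ i j → A H i j ∧ D i ≡ (A H′ i j ∧ D′ i) ∨ P i j) →
          (∀ i j → A H′ i j ∧ D′ i ≡ true → P i j ≡ true → ⊥) → Υ_ ψ H D ≡ Υ_ ψ H′ D′ +ʷ weight P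
    Υ-∪ {H} {H′} {D} {D′} P same disjoint = begin
      Υ_ ψ H D                                               ≡⟨ Υ≡weight H D ⟩
      weight (λ i j → A H i j ∧ D i)                         ≡⟨ weight-cong same ⟩
      weight (λ i j → (A H′ i j ∧ D′ i) ∨ P i j)             ≡⟨ weight-∪ _ P disjoint ⟩
      weight (λ i j → A H′ i j ∧ D′ i) +ʷ weight P           ≡˘⟨ cong (_+ʷ weight P) (Υ≡weight H′ D′) ⟩
      Υ_ ψ H′ D′ +ʷ weight P                                 ∎
      where open ≡-Reasoning

    Υ-split : ∀ G D → Υall ψ G ≡ Υ_ ψ G D +ʷ Υ_ ψ G (λ i → not (D i))
    Υ-split G D = begin
      Υall ψ G                                                       ≡⟨ Υ≡weight G _ ⟩
      weight (λ i j → A G i j ∧ true)                                ≡⟨ weight-cong (λ i j → split (A G i j) (D i)) ⟩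
      weight (λ i j → (A G i j ∧ D i) ∨ (A G i j ∧ not (D i)))       ≡⟨ weight-∪ _ _ (λ i j → disjoint (A G i j) (D i)) ⟩
      weight (λ i j → A G i j ∧ D i) +ʷ weight (λ i j → A G i j ∧ not (D i))
                                                                     ≡˘⟨ cong₂ _+ʷ_ (Υ≡weight G D) (Υ≡weight G _) ⟩
      Υ_ ψ G D +ʷ Υ_ ψ G (λ i → not (D i))                           ∎
      where
      open ≡-Reasoning
      split : ∀ a d → a ∧ true ≡ (a ∧ d) ∨ (a ∧ not d)
      split true  true  = refl
      split true  false = refl
      split false _     = refl
      disjoint : ∀ a d → a ∧ d ≡ true → a ∧ not d ≡ true → ⊥
      disjoint true true  _ ()
      disjoint true false ()

    Υ-blocks : ∀ {m} (blk : Fin n → Fin m) G → Υall ψ G ≡ sumFin (λ B → Υ_ ψ G (Block blk B))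
    Υ-blocks {m} blk G = sym (begin
      sumFin (λ B → Υ_ ψ G (Block blk B))                    ≡⟨ sumFin≡sum (λ B → Υ_ ψ G (Block blk B)) ⟩
      sum (λ B → Υ_ ψ G (Block blk B))                       ≡⟨ sum-cong-≗ (λ B → Υ≡weight G (Block blk B)) ⟩
      sum (λ B → sum (λ i → sum (λ j → term B i j)))         ≡⟨ ∑-comm (λ B i → sum (term B i)) ⟩
      sum (λ i → sum (λ B → sum (λ j → term B i j)))         ≡⟨ sum-cong-≗ (λ i → ∑-comm (λ B j → term B i j)) ⟩
      sum (λ i → sum (λ j → sum (λ B → term B i j)))         ≡⟨ sum-cong-≗ (λ i → sum-cong-≗ (λ j → one-block i j (A G i j))) ⟩
      weight (λ i j → A G i j ∧ true)                        ≡˘⟨ Υ≡weight G _ ⟩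
      Υall ψ G                                               ∎)
      where
      open ≡-Reasoning
      term : Fin m → Fin n → Fin n → W
      term B i j = if A G i j ∧ Block blk B i then ψ i j else 0ʷ
      one-block : ∀ i j a → sum (λ B → if a ∧ Block blk B i then ψ i j else 0ʷ) ≡
                            (if a ∧ true then ψ i j else 0ʷ)
      one-block i j true  = sum-indicator (blk i) (ψ i j)
      one-block i j false = sum-replicate-zero m

    Υ-tree-at-root : ∀ {G D u U} → Tbq G D u U → Functional G → IsRoot G u → Υall ψ U ≡ Υ_ ψ G D
    Υ-tree-at-root {G} {D} {u} {U} t functional root =
      Υall-cong {U} {G} {D} (TreeIn.arcs-at-root {G = G} {D} {u} {U} t functional root)

    Υ-restriction : ∀ {G D u U} → Tbq G D u U → Functional G → Acyclic G → Υall ψ (G ∣ D) ≡ Υall ψ U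
    Υ-restriction {G} {D} {u} {U} t functional acyclic =
      Υall-cong {G ∣ D} {U} {λ _ → true} (λ i j →
        trans (TreeIn.arcs-of-restriction {G = G} {D} {u} {U} t functional acyclic i j) (sym (∧-identityʳ (A U i j))))

    Υ-Txy : ∀ {m} {blk : Fin n → Fin m} {G X Y T} → Txy G blk X Y T → X ≢ Y → Functional G →
            Υall ψ T ≡ Υ_ ψ G (Block blk X)
    Υ-Txy {blk = blk} {G} {X} {Y} {T} txy X≢Y functional =
      Υall-cong {T} {G} {Block blk X} (TxyTree.arcs blk {G} {X} {Y} {T} txy X≢Y functional)

module Minimality (OG : OrderedAbelianGroup) {n m : ℕ} (k : ℕ) (Ψ : Subgraph n) (blk : Fin n → Fin m)
                  (F′ : Subgraph m) (ψ : Fin n → Fin n → OrderedAbelianGroup.W OG) (F : Subgraph n) where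
  open OrderedAbelianGroup OG
  open Weighted OG
  open Weights OG

  module _ {G : Subgraph n} (principal : Principal k Ψ blk F′ G) where
    open OfPrincipal {k = k} {Ψ} {blk} {F′} {G} principal

    Υ-root-tree : ∀ X → IsRoot G (root X) → Υall ψ (tree X) ≡ Υ_ ψ G (Block blk X)
    Υ-root-tree X = Υ-tree-at-root ψ {G} {Block blk X} {root X} {tree X} (tree-∈Tbq X) functional

    Υ-split-tree : ∀ {X Y T} → Txy G blk X Y T → X ≢ Y → Υall ψ T ≡ Υ_ ψ G (Block blk X)
    Υ-split-tree {X} {Y} {T} txy X≢Y = Υ-Txy ψ {blk = blk} {G} {X} {Y} {T} txy X≢Y functional

  module _ (minimal : MinimalPrincipal ψ k Ψ blk F′ F) where
    open OfPrincipal {k = k} {Ψ} {blk} {F′} {F} (proj₁ minimal)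

    module Replace (X : Fin m) (S : Subgraph n) (S⊆Ψ : ∀ {i j} → Arc S i j → Arc Ψ i j)
                   (S-forest : EnteringForest S) (S-tails : ∀ {i j} → Arc S i j → Block blk X i ≡ true) where
      open Replacement {k = k} {Ψ} {blk} {F′} {F} (proj₁ minimal) X S S⊆Ψ S-forest S-tails public

      bound : Principal k Ψ blk F′ replaced → Υ_ ψ F inX ≤ʷ Υall ψ S
      bound replaced-principal = +-cancelʳ-≤ (Υ_ ψ F outX)
        (subst₂ _≤ʷ_ (Υ-split ψ F inX) split-replaced (proj₂ minimal replaced replaced-principal))
        where
        outX : VSet n
        outX i = not (inX i)
        inside : ∀ i j → A replaced i j ∧ inX i ≡ A S i j ∧ true
        inside i j with inX i in i∈X
        ... | true  = refl
        ... | false = trans (∧-zeroʳ (A F i j))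
                            (sym (trans (∧-identityʳ (A S i j)) (¬-not (λ s → not-¬ (S-tails s) i∈X))))
        outside : ∀ i j → A replaced i j ∧ outX i ≡ A F i j ∧ outX i
        outside i j with inX i
        ... | true  = trans (∧-zeroʳ (A S i j)) (sym (∧-zeroʳ (A F i j)))
        ... | false = refl
        split-replaced : Υall ψ replaced ≡ Υall ψ S +ʷ Υ_ ψ F outX
        split-replaced = trans (Υ-split ψ replaced inX)
          (cong₂ _+ʷ_ (Υ-cong ψ {replaced} {S} {inX} inside) (Υ-cong ψ {replaced} {F} {outX} outside))

    module BlockCompetitor {X s T} (root-X : IsRoot F (root X)) (t : Tbq Ψ (Block blk X) s T) where
      module Tt = TreeIn {G = Ψ} {Block blk X} {s} {T} t
      open Replace X T Tt.U-arc⇒G-arc (proj₁ Tt.tree) (proj₁ ∘ Tt.arc-inside)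

      t′ : Tbq replaced inX s T
      t′ = Tbq-⊆ᵍ {G = Ψ} {replaced} {inX} {s} {T} t
             ((λ _ _ → refl) , λ i j a → S-arc⇒replaced (proj₁ (Tt.arc-inside a)) a)

      no-arc-from-s : ∀ j → ¬ Arc replaced s j
      no-arc-from-s j a = root-has-no-arc {H = T} (proj₁ (proj₂ Tt.tree)) (replaced⇒S-arc Tt.root-inside a)

      same-roots : rootsIn inX replaced ≡ rootsIn inX F
      same-roots = trans
        (rootsIn-≡1 {H = replaced} (refl , no-arc-from-s) Tt.root-inside
          (λ i i∈X i≢s → let c , a = Tt.step i∈X i≢s in c , S-arc⇒replaced i∈X a))
        (sym (rootsIn-≡1 {H = F} root-X (Tree.root-inside X) (λ i → Tree.G-step X)))

      no-split-arcs : SplitArcsAt X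
      no-split-arcs C =
        (λ XC → ⊥-elim (root-has-no-arc {H = F} root-X (proj₁ (proj₂ (F′-arc⇒root-arc XC))))) ,
        (λ XC → ⊥-elim (no-arc-from-s _ (proj₁ (proj₂
          (SplitArc⇒root-arc blk {replaced} {X} {s} {T} t′ replaced-functional XC)))))

      block-tree-bound : Υ_ ψ F (Block blk X) ≤ʷ Υall ψ T
      block-tree-bound = bound (replaced-principal exits (T , s , t′) same-roots no-split-arcs)
        where
        exits : ExitsTowardsRoots
        exits a j∉X = ⊥-elim (not-¬ (proj₂ (Tt.arc-inside a)) j∉X)

    open BlockCompetitor using (block-tree-bound)

    module ArcCompetitor (F′-functional : Functional F′) {X Y T} (XY : Arc F′ X Y) (txy : Txy Ψ blk X Y T) where
      X≢Y : X ≢ Y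
      X≢Y = proj₁ (F′-arc⇒SplitArc XY)

      module Tt = TxyTree blk {Ψ} {X} {Y} {T} txy X≢Y
      open Replace X T Tt.T-arc⇒G-arc (proj₁ (proj₁ (proj₂ (proj₂ txy)))) Tt.tails-inside

      r∈Y : blk (proj₁ (proj₂ txy)) ≡ Y
      r∈Y = proj₂ (proj₂ (proj₂ txy))

      x : Fin n
      x = proj₁ (proj₂ (proj₂ (proj₂ (proj₂ (proj₁ txy)))))

      tx : Tbq Ψ inX x (T ∣ inX)
      tx = proj₂ (proj₂ (proj₂ (proj₂ (proj₂ (proj₁ txy)))))

      T⊆replaced : T ⊆ᵍ replaced
      T⊆replaced = (λ _ _ → refl) , λ i j a → S-arc⇒replaced (Tt.tails-inside a) a

      tx′ : Tbq replaced inX x (T ∣ inX)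
      tx′ = Tbq-⊆ᵍ {G = Ψ} {replaced} {inX} {x} {T ∣ inX} tx
              (⊆ᵍ-trans {H = T ∣ inX} {T} {replaced} (∣-⊆ᵍ T inX) T⊆replaced)

      y = proj₁ (F′-arc⇒root-arc XY)

      root-y : Arc F (root X) y
      root-y = proj₁ (proj₂ (F′-arc⇒root-arc XY))

      exits : ExitsTowardsRoots
      exits {i} {j} a j∉X = subst (X ⇝_) y≡j (root-y ◅⁺ reaches-own-root y)
        where
        y≡j : blk y ≡ blk j
        y≡j = trans (proj₂ (proj₂ (F′-arc⇒root-arc XY)))
                    (sym (trans (cong blk (Tt.only-root-outside (proj₂ (closed T i j a)) j∉X)) r∈Y))

      same-roots : rootsIn inX replaced ≡ rootsIn inX F
      same-roots = trans (rootsIn-≡0 {H = replaced} (λ i i∈X → let c , a = Tt.step i∈X in c , S-arc⇒replaced i∈X a))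
                         (sym (rootsIn-≡0 {H = F} F-arc-in-X))
        where
        F-arc-in-X : ∀ i → inX i ≡ true → ∃ (Arc F i)
        F-arc-in-X i i∈X with i ≟ root X
        ... | yes refl = y , root-y
        ... | no  i≢r  = Tree.G-step X i∈X i≢r

      from-F′ : ∀ {C} → Arc F′ X C → SplitArc replaced blk X C
      from-F′ {C} XC = subst (SplitArc replaced blk X) (F′-functional X Y C XY XC)
                             (X≢Y , T , Txy-⊆ᵍ blk {Ψ} {replaced} {X} {Y} {T} txy T⊆replaced)

      -- The split arc out of X is the T-arc from x, which can only end at the root of T.
      to-F′ : ∀ {C} → SplitArc replaced blk X C → Arc F′ X C
      to-F′ {C} XC = subst (Arc F′ X) Y≡C XY
        where
        arc = SplitArc⇒root-arc blk {replaced} {X} {x} {T ∣ inX} tx′ replaced-functional XC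
        z = proj₁ arc
        xz : Arc T x z
        xz = replaced⇒S-arc (TreeIn.root-inside {G = Ψ} {inX} {x} {T ∣ inX} tx) (proj₁ (proj₂ arc))
        z∉X : inX z ≡ false
        z∉X = ∉Block blk (λ z∈X → proj₁ XC (trans (sym z∈X) (proj₂ (proj₂ arc))))
        Y≡C : Y ≡ C
        Y≡C = trans (sym r∈Y)
                    (trans (cong blk (sym (Tt.only-root-outside (proj₂ (closed T x z xz)) z∉X))) (proj₂ (proj₂ arc)))

      arc-tree-bound : Υ_ ψ F (Block blk X) ≤ʷ Υall ψ T
      arc-tree-bound = bound (replaced-principal exits (T ∣ inX , x , tx′) same-roots (λ C → from-F′ , to-F′))

    open ArcCompetitor using (arc-tree-bound)

    module AttachedCompetitor (F′-functional : Functional F′) {X y S}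
                              (root-y : Arc F (root X) y) (s : Tbq Ψ (Block blk X) (root X) S) where
      inX = Block blk X

      y∉X : inX y ≡ false
      y∉X = Tree.root-arc-leaves X functional acyclic root-y

      module Ts = TreeIn {G = Ψ} {inX} {root X} {S} s
      open Attach {G = Ψ} {inX} {root X} {S} s y y∉X

      new-arc-cases : ∀ {i j} → new-arc i j ≡ true → i ≡ root X × j ≡ y
      new-arc-cases {i} e = let i≡r , j≡y = ∧-elim ⌊ i ≟ root X ⌋ e in ≟-sound i≡r , ≟-sound j≡y

      restricted-arc⁻ : ∀ {i j} → A (F ∣ inX) i j ∧ true ≡ true → Arc F i j × inX i ≡ true × inX j ≡ true
      restricted-arc⁻ {i} {j} e = ∣-arc⁻ {H = F} {inX} (proj₁ (∧-elim (A (F ∣ inX) i j) e))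

      F-arcs : ∀ i j → A F i j ∧ inX i ≡ (A (F ∣ inX) i j ∧ true) ∨ new-arc i j
      F-arcs i j = ⇔→≡ (mk⇔ to from)
        where
        to : A F i j ∧ inX i ≡ true → (A (F ∣ inX) i j ∧ true) ∨ new-arc i j ≡ true
        to e with ∧-elim (A F i j) e | true-or-false (inX j)
        ... | a , i∈X | inj₁ j∈X = ∨-introˡ _ (∧-intro (∣-arc {H = F} {inX} a i∈X j∈X) refl)
        ... | a , i∈X | inj₂ j∉X with Tree.leaving-arc-from-root X functional a i∈X j∉X
        ...   | refl = ∨-introʳ _ (∧-intro (≟-refl (root X)) (≟-complete (functional _ j y a root-y)))
        from : (A (F ∣ inX) i j ∧ true) ∨ new-arc i j ≡ true → A F i j ∧ inX i ≡ true
        from e with ∨-elim (A (F ∣ inX) i j ∧ true) e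
        ... | inj₁ restricted = let a , i∈X , _ = restricted-arc⁻ restricted in ∧-intro a i∈X
        ... | inj₂ new with new-arc-cases {i} {j} new
        ...   | refl , refl = ∧-intro root-y (Tree.root-inside X)

      F-split : Υ_ ψ F inX ≡ Υall ψ (F ∣ inX) +ʷ weight ψ new-arc
      F-split = Υ-∪ ψ {F} {F ∣ inX} {inX} {λ _ → true} new-arc F-arcs disjoint
        where
        disjoint : ∀ i j → A (F ∣ inX) i j ∧ true ≡ true → new-arc i j ≡ true → ⊥
        disjoint i j restricted new with new-arc-cases {i} {j} new
        ... | _ , refl = not-¬ (proj₂ (proj₂ (restricted-arc⁻ restricted))) y∉X

      S-split : Υall ψ extended ≡ Υall ψ S +ʷ weight ψ new-arc
      S-split = Υ-∪ ψ {extended} {S} {λ _ → true} {λ _ → true} new-arc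
        (λ i j → trans (∧-identityʳ _) (cong (_∨ new-arc i j) (sym (∧-identityʳ (A S i j)))))
        disjoint
        where
        disjoint : ∀ i j → A S i j ∧ true ≡ true → new-arc i j ≡ true → ⊥
        disjoint i j a new with new-arc-cases {i} {j} new
        ... | refl , _ = root-has-no-arc {H = S} (proj₁ (proj₂ Ts.tree)) (proj₁ (∧-elim (A S i j) a))

      restriction-bound : Υall ψ (F ∣ inX) ≤ʷ Υall ψ S
      restriction-bound = +-cancelʳ-≤ (weight ψ new-arc) (subst₂ _≤ʷ_ F-split S-split
        (arc-tree-bound F′-functional {X} {blk y} {extended} (root-arc⇒F′-arc root-y) txy))
        where
        txy : Txy Ψ blk X (blk y) extended
        txy = extended-∈Tc Ψ-spanning (proj₂ F⊆Ψ _ _ root-y) , y , extended-tree , refl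

    open AttachedCompetitor using (restriction-bound)

    minimal⇒root-blocks : ∀ Z → (∃ λ r → IsRoot F r × (blk r ≡ Z)) →
                          IsMinOf ψ (Tb Ψ (Block blk Z)) (Υ_ ψ F (Block blk Z))
    minimal⇒root-blocks Z (r , root-r , r∈Z) =
      (tree Z , (root Z , tree-∈Tbq-Ψ Z) , Υ-root-tree {F} (proj₁ minimal) Z root-Z) ,
      λ T (s , t) → block-tree-bound {Z} {s} {T} root-Z t
      where
      root-Z : IsRoot F (root Z)
      root-Z = subst (IsRoot F) (root-in-block root-r (∈Block blk r∈Z)) root-r

    minimal⇒arc-blocks : Functional F′ → ∀ X Y → Arc F′ X Y → IsMinOf ψ (Txy Ψ blk X Y) (Υ_ ψ F (Block blk X))
    minimal⇒arc-blocks F′-functional X Y XY with F′-arc⇒SplitArc XY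
    ... | X≢Y , T , txy = (T , Txy-in-Ψ {X} {Y} {T} txy , Υ-split-tree {F} (proj₁ minimal) {X} {Y} {T} txy X≢Y) ,
                          λ S → arc-tree-bound F′-functional {X} {Y} {S} XY

    minimal⇒restrictions : Functional F′ → ∀ X x → IsRoot (F ∣ Block blk X) x →
                           IsMinOf ψ (Tbq Ψ (Block blk X) x) (Υall ψ (F ∣ Block blk X))
    minimal⇒restrictions F′-functional X x root-x rewrite Tree.restriction-root X root-x =
      (tree X , tree-∈Tbq-Ψ X , sym restriction-weight) , lower-bound
      where
      restriction-weight : Υall ψ (F ∣ Block blk X) ≡ Υall ψ (tree X)
      restriction-weight = Υ-restriction ψ {F} {Block blk X} {root X} {tree X} (tree-∈Tbq X) functional acyclic
      lower-bound : ∀ S → Tbq Ψ (Block blk X) (root X) S → Υall ψ (F ∣ Block blk X) ≤ʷ Υall ψ S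
      lower-bound S s with root-or-arc X
      ... | inj₁ root-X = subst (_≤ʷ Υall ψ S)
                                (trans (sym (Υ-root-tree {F} (proj₁ minimal) X root-X)) (sym restriction-weight))
                                (block-tree-bound {X} {root X} {S} root-X s)
      ... | inj₂ (y , root-y) = restriction-bound F′-functional {X} {y} {S} root-y s

  module _ (principal : Principal k Ψ blk F′ F) where
    open OfPrincipal {k = k} {Ψ} {blk} {F′} {F} principal

    blockwise-minimal⇒minimal :
      (∀ Z → (∃ λ r → IsRoot F r × (blk r ≡ Z)) → IsMinOf ψ (Tb Ψ (Block blk Z)) (Υ_ ψ F (Block blk Z))) →
      (∀ X Y → Arc F′ X Y → IsMinOf ψ (Txy Ψ blk X Y) (Υ_ ψ F (Block blk X))) →
      ∀ F₂ → Principal k Ψ blk F′ F₂ → Υall ψ F ≤ʷ Υall ψ F₂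
    blockwise-minimal⇒minimal root-blocks arc-blocks F₂ principal₂ =
      subst₂ _≤ʷ_ (sym (Υ-blocks ψ blk F)) (sym (Υ-blocks ψ blk F₂)) (sumFin-mono-≤ per-block)
      where
      module F₂ = OfPrincipal {k = k} {Ψ} {blk} {F′} {F₂} principal₂
      per-block : ∀ B → Υ_ ψ F (Block blk B) ≤ʷ Υ_ ψ F₂ (Block blk B)
      per-block B with root-or-arc B
      ... | inj₂ (y , root-y) with F₂.F′-arc⇒SplitArc (root-arc⇒F′-arc root-y)
      ...   | B≢C , T , txy =
        subst (Υ_ ψ F (Block blk B) ≤ʷ_) (Υ-split-tree {F₂} principal₂ {B} {blk y} {T} txy B≢C)
              (proj₂ (arc-blocks B (blk y) (root-arc⇒F′-arc root-y)) T (F₂.Txy-in-Ψ {B} {blk y} {T} txy))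
      per-block B | inj₁ root-B with F₂.root-or-arc B
      ... | inj₂ (y , root₂-y) =
        ⊥-elim (root-has-no-arc {H = F} root-B (proj₁ (proj₂ (F′-arc⇒root-arc (F₂.root-arc⇒F′-arc root₂-y)))))
      ... | inj₁ root₂-B = subst (Υ_ ψ F (Block blk B) ≤ʷ_) (Υ-root-tree {F₂} principal₂ B root₂-B)
                             (proj₂ (root-blocks B (root B , root-B , Block-sound blk (Tree.root-inside B)))
                               (F₂.tree B) (F₂.root B , F₂.tree-∈Tbq-Ψ B))

theorem1 : (OG : OrderedAbelianGroup) →
  let open OrderedAbelianGroup OG
      open Weighted OG
  in ∀ {n m : ℕ} (k : ℕ)
     (Ψ : Subgraph n) (ψ : Fin n → Fin n → W) (blk : Fin n → Fin m) →
     Spanning Ψ → IsPartition blk → TreeDivisible Ψ blk →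
     (F′ : Subgraph m) → InSplitForests k Ψ blk F′ →
     (F : Subgraph n) → Principal k Ψ blk F′ F →
     MinimalPrincipal ψ k Ψ blk F′ F ⇔
     ( (∀ Z → (∃ λ r → IsRoot F r × (blk r ≡ Z)) →
          IsMinOf ψ (Tb Ψ (Block blk Z)) (Υ_ ψ F (Block blk Z)))
     × (∀ X Y → Arc F′ X Y →
          IsMinOf ψ (Txy Ψ blk X Y) (Υ_ ψ F (Block blk X)))
     × (∀ X x → IsRoot (F ∣ Block blk X) x →
          IsMinOf ψ (Tbq Ψ (Block blk X) x) (Υall ψ (F ∣ Block blk X))) )
theorem1 OG k Ψ ψ blk _ _ _ F′ F′-forest F principal =
  -- Spanning Ψ follows from F ⊆ Ψ.
  mk⇔
  (λ minimal → minimal⇒root-blocks minimal ,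
               minimal⇒arc-blocks minimal F′-functional ,
               minimal⇒restrictions minimal F′-functional)
  (λ (root-blocks , arc-blocks , _) → principal , blockwise-minimal⇒minimal principal root-blocks arc-blocks)
  where
  open Minimality OG k Ψ blk F′ ψ F
  F′-functional : Functional F′
  F′-functional = proj₁ (proj₁ (proj₂ (proj₂ F′-forest)))
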